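{- Let $h,k \in \mathbf{N}$ and $m,c \in \mathbf{Z}$. For $n \in \mathbf{N}$ let $I_{m,n} = \{m, m+1, \ldots, m+n-1\}$ and let $\Phi^{(c)}_{h,k,m}(n)$ denote the number of $(h+k)$-tuples $(a_1,\ldots,a_{h+k}) \in I_{m,n}^{h+k}$ such that \[ a_1 + \cdots + a_h - a_{h+1} - \cdots - a_{h+k} = c. \] Then there exists a number $\theta = \theta(h,k,m,c) > 0$ such that \[ \theta n^{h+k-1} \le \Phi^{(c)}_{h,k,m}(n) \le n^{h+k-1} \] for all sufficiently large integers $n$.
   Context: $\mathbf{N}$ denotes the positive integers and $\mathbf{Z}$ the integers. -}

module Defs where

open import Data.Nat as ℕ using (ℕ; zero; suc)
open import Data.Integer as ℤ using (ℤ; +_)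
open import Data.List using (List; []; _∷_; map; upTo; concatMap; filter; length)
open import Data.Vec using (Vec; []; _∷_; splitAt)
open import Data.Product using (_,_)
open import Data.Fin using (Fin)

interval : ℤ → ℕ → List ℤ
interval m n = map (λ i → m ℤ.+ + i) (upTo n)

tuples : (j : ℕ) → List ℤ → List (Vec ℤ j)
tuples zero    xs = [] ∷ []
tuples (suc j) xs = concatMap (λ x → map (x ∷_) (tuples j xs)) xs

sumV : ∀ {j} → Vec ℤ j → ℤ
sumV []       = + 0
sumV (x ∷ v) = x ℤ.+ sumV v

signedSum : (h k : ℕ) → Vec ℤ (h ℕ.+ k) → ℤ
signedSum h k v with splitAt h v
... | (xs , ys , _) = sumV xs ℤ.- sumV ys

Φ : (h k : ℕ) (m c : ℤ) (n : ℕ) → ℕ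
Φ h k m c n =
  length (filter (λ v → signedSum h k v ℤ.≟ c) (tuples (h ℕ.+ k) (interval m n)))

{-# OPTIONS --safe #-}
module Submission where

-- Peeling off the first coordinate writes Φ for h + k coordinates as a sum of n shifted copies
-- of Φ for one coordinate less.  Upper bound: Φ₀,₁ is an indicator, and every further coordinate
-- costs a factor n.  Lower bound: put w = ⌊n/M⌋ and r = n − 1 − 2w.  If a count is ≥ L on a
-- window of targets of length ℓ ≥ w, then after one more coordinate it is ≥ (w+1)L on a window of
-- length ℓ + r, because for every target some w + 1 consecutive values of the new coordinate
-- leave the remaining target in the old window (negative coordinates: reflect S ↦ −S).  Starting
-- from Φ₀,₁ on a window of length n − 1, after h + k − 1 steps the window contains c as soon as
-- r ≥ (h+k)w + |c + (k−h)m|, so Φ ≥ (w+1)^(h+k−1) ≥ (n/M)^(h+k−1) for large n.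

open import Defs

module Sums where
  open import Data.Nat using (ℕ; zero; suc; _+_; _*_; _∸_; _≤_; _<_; z≤n; s≤s; z<s; s<s)
  import Data.Nat.Properties as ℕₚ
  open import Data.Nat.ListAction using (sum)
  open import Data.List using (List; []; _∷_; _++_; map; applyUpTo; concatMap; filter; length)
  open import Data.List.Properties using (filter-++; length-++)
  open import Function using (_∘_)
  open import Data.Bool using (true; false)
  open import Relation.Nullary using (does)
  open import Relation.Unary using (Pred; Decidable)
  open import Relation.Binary.PropositionalEquality

  sumBelow : ℕ → (ℕ → ℕ) → ℕ
  sumBelow zero    f = 0
  sumBelow (suc n) f = f 0 + sumBelow n (f ∘ suc)

  syntax sumBelow n (λ i → e) = ∑[ i < n ] e

  sumBelow-cong : ∀ n {f g : ℕ → ℕ} → (∀ i → f i ≡ g i) → sumBelow n f ≡ sumBelow n g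
  sumBelow-cong zero    f≗g = refl
  sumBelow-cong (suc n) f≗g = cong₂ _+_ (f≗g 0) (sumBelow-cong n (f≗g ∘ suc))

  sumBelow-+ : ∀ a b (f : ℕ → ℕ) → sumBelow (a + b) f ≡ sumBelow a f + ∑[ j < b ] f (a + j)
  sumBelow-+ zero    b f = refl
  sumBelow-+ (suc a) b f =
    trans (cong (f 0 +_) (sumBelow-+ a b (f ∘ suc))) (sym (ℕₚ.+-assoc (f 0) _ _))

  sumBelow-≤ : ∀ n {f : ℕ → ℕ} {B} → (∀ i → f i ≤ B) → sumBelow n f ≤ n * B
  sumBelow-≤ zero    f≤B = z≤n
  sumBelow-≤ (suc n) f≤B = ℕₚ.+-mono-≤ (f≤B 0) (sumBelow-≤ n (f≤B ∘ suc))

  sumBelow-≥ : ∀ n {f : ℕ → ℕ} {L} → (∀ i → i < n → L ≤ f i) → n * L ≤ sumBelow n f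
  sumBelow-≥ zero    L≤f = z≤n
  sumBelow-≥ (suc n) L≤f =
    ℕₚ.+-mono-≤ (L≤f 0 z<s) (sumBelow-≥ n (λ i i<n → L≤f (suc i) (s<s i<n)))

  sumBelow-window : ∀ {n} (f : ℕ → ℕ) {L} a w → a + suc w ≤ n →
    (∀ j → j ≤ w → L ≤ f (a + j)) → suc w * L ≤ sumBelow n f
  sumBelow-window {n} f {L} a w a+w<n L≤f = begin
    suc w * L                                   ≤⟨ sumBelow-≥ (suc w) (λ j → L≤f j ∘ ℕₚ.≤-pred) ⟩
    ∑[ j < suc w ] f (a + j)                    ≤⟨ ℕₚ.m≤n+m _ (sumBelow a f) ⟩
    sumBelow a f + ∑[ j < suc w ] f (a + j)     ≡⟨ sumBelow-+ a (suc w) f ⟨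
    sumBelow (a + suc w) f                      ≤⟨ ℕₚ.m≤m+n _ _ ⟩
    sumBelow (a + suc w) f + _                  ≡⟨ sumBelow-+ (a + suc w) (n ∸ (a + suc w)) f ⟨
    sumBelow (a + suc w + (n ∸ (a + suc w))) f  ≡⟨ cong (λ k → sumBelow k f) (ℕₚ.m+[n∸m]≡n a+w<n) ⟩
    sumBelow n f                                ∎
    where open ℕₚ.≤-Reasoning

  sumBelow-zero : ∀ n {f : ℕ → ℕ} → (∀ i → f i ≡ 0) → sumBelow n f ≡ 0
  sumBelow-zero zero    f≡0 = refl
  sumBelow-zero (suc n) f≡0 = cong₂ _+_ (f≡0 0) (sumBelow-zero n (f≡0 ∘ suc))

  sumBelow-≤1 : ∀ n {f : ℕ → ℕ} → (∀ i → f i ≤ 1) → (∀ i j → 0 < f i → 0 < f j → i ≡ j) →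
    sumBelow n f ≤ 1
  sumBelow-≤1 zero    f≤1 inj = z≤n
  sumBelow-≤1 (suc n) {f} f≤1 inj with f 0 in f0≡ | f≤1 0
  ... | zero  | _ =
    sumBelow-≤1 n (f≤1 ∘ suc) (λ i j p q → ℕₚ.suc-injective (inj (suc i) (suc j) p q))
  ... | suc _ | s≤s z≤n = ℕₚ.≤-reflexive (cong suc (sumBelow-zero n vanish))
    where
    vanish : ∀ i → f (suc i) ≡ 0
    vanish i with f (suc i) in fi≡
    ... | zero  = refl
    ... | suc _ with () ← inj (suc i) 0 (ℕₚ.≤-trans z<s (ℕₚ.≤-reflexive (sym fi≡)))
                                       (ℕₚ.≤-trans z<s (ℕₚ.≤-reflexive (sym f0≡)))

  sum-applyUpTo : ∀ (f : ℕ → ℕ) n → sum (applyUpTo f n) ≡ sumBelow n f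
  sum-applyUpTo f zero    = refl
  sum-applyUpTo f (suc n) = cong (f 0 +_) (sum-applyUpTo (f ∘ suc) n)

  module _ {a p} {A : Set a} {P : Pred A p} (P? : Decidable P) where

    length-filter-concatMap : ∀ {b} {B : Set b} (f : B → List A) xs →
      length (filter P? (concatMap f xs)) ≡ sum (map (λ x → length (filter P? (f x))) xs)
    length-filter-concatMap f []       = refl
    length-filter-concatMap f (x ∷ xs) = begin
      length (filter P? (f x ++ concatMap f xs))                  ≡⟨ cong length (filter-++ P? (f x) _) ⟩
      length (filter P? (f x) ++ filter P? (concatMap f xs))      ≡⟨ length-++ (filter P? (f x)) ⟩
      length (filter P? (f x)) + length (filter P? (concatMap f xs))
        ≡⟨ cong (length (filter P? (f x)) +_) (length-filter-concatMap f xs) ⟩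
      sum (map (λ x → length (filter P? (f x))) (x ∷ xs))         ∎
      where open ≡-Reasoning

    length-filter-map : ∀ {b} {B : Set b} (g : B → A) xs →
      length (filter P? (map g xs)) ≡ length (filter (P? ∘ g) xs)
    length-filter-map g []       = refl
    length-filter-map g (x ∷ xs) with does (P? (g x))
    ... | true  = cong suc (length-filter-map g xs)
    ... | false = length-filter-map g xs

module Recurrence where
  open Sums
  open import Data.Nat as ℕ using (ℕ; zero; suc; _^_; z≤n; s≤s)
  open import Data.Nat.ListAction using (sum)
  open import Data.Integer using (ℤ; +_; _+_; _-_; _≟_)
  import Data.Integer.Properties as ℤₚ
  open import Data.Integer.Tactic.RingSolver using (solve-∀)
  open import Data.List using (List; map; upTo; applyUpTo; filter; length)
  open import Data.List.Properties using (filter-≐; map-cong; map-applyUpTo)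
  open import Data.Vec using (Vec; []; _∷_)
  open import Data.Product using (_,_)
  open import Function using (_∘_)
  open import Relation.Nullary using (yes; no)
  open import Relation.Unary using (_≐_)
  open import Relation.Binary.PropositionalEquality
  open ≡-Reasoning

  solutions : ∀ {j} → (Vec ℤ j → ℤ) → ℤ → List ℤ → ℕ
  solutions {j} f S xs = length (filter (λ v → f v ≟ S) (tuples j xs))

  solutions-∷ : ∀ {j} (f : Vec ℤ (suc j) → ℤ) (g : Vec ℤ j → ℤ) S (t : ℤ → ℤ) xs →
    (∀ x → (λ v → f (x ∷ v) ≡ S) ≐ (λ v → g v ≡ t x)) →
    solutions f S xs ≡ sum (map (λ x → solutions g (t x) xs) xs)
  solutions-∷ {j} f g S t xs f≐g = begin
    solutions f S xs                                       ≡⟨ length-filter-concatMap P? _ xs ⟩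
    sum (map (λ x → length (filter P? (map (x ∷_) T))) xs) ≡⟨ cong sum (map-cong peel xs) ⟩
    sum (map (λ x → solutions g (t x) xs) xs)              ∎
    where
    T = tuples j xs
    P? = λ v → f v ≟ S
    peel : ∀ x → length (filter P? (map (x ∷_) T)) ≡ solutions g (t x) xs
    peel x = trans (length-filter-map P? (x ∷_) T)
                   (cong length (filter-≐ _ (λ v → g v ≟ t x) (f≐g x) T))

  sum-map-interval : ∀ (f : ℤ → ℕ) m n → sum (map f (interval m n)) ≡ ∑[ i < n ] f (m + + i)
  sum-map-interval f m n = begin
    sum (map f (map (λ i → m + + i) (upTo n)))  ≡⟨ cong (sum ∘ map f) (map-applyUpTo _ _ n) ⟩
    sum (map f (applyUpTo (λ i → m + + i) n))   ≡⟨ cong sum (map-applyUpTo _ f n) ⟩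
    sum (applyUpTo (λ i → f (m + + i)) n)       ≡⟨ sum-applyUpTo _ n ⟩
    ∑[ i < n ] f (m + + i)                      ∎

  signedSum-∷⁺ : ∀ h k x v → signedSum (suc h) k (x ∷ v) ≡ x + signedSum h k v
  signedSum-∷⁺ h k x v = ℤₚ.+-assoc x _ _

  signedSum-∷⁻ : ∀ k x v → signedSum 0 (suc k) (x ∷ v) ≡ signedSum 0 k v - x
  signedSum-∷⁻ k x v = lemma x (sumV v)
    where
    lemma : ∀ x y → + 0 - (x + y) ≡ (+ 0 - y) - x
    lemma = solve-∀

  x+y-x≡y : ∀ x y → (x + y) - x ≡ y
  x+y-x≡y = solve-∀

  x+[y-x]≡y : ∀ x y → x + (y - x) ≡ y
  x+[y-x]≡y = solve-∀

  y-x+x≡y : ∀ x y → (y - x) + x ≡ y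
  y-x+x≡y = solve-∀

  y+x-x≡y : ∀ x y → (y + x) - x ≡ y
  y+x-x≡y = solve-∀

  Φ-suc⁺ : ∀ h k m S n → Φ (suc h) k m S n ≡ ∑[ i < n ] Φ h k m (S - (m + + i)) n
  Φ-suc⁺ h k m S n =
    trans (solutions-∷ (signedSum (suc h) k) (signedSum h k) S (_-_ S) (interval m n) equiv)
          (sum-map-interval _ m n)
    where
    equiv : ∀ x → (λ v → signedSum (suc h) k (x ∷ v) ≡ S) ≐ (λ v → signedSum h k v ≡ S - x)
    equiv x = (λ {v} e → trans (sym (x+y-x≡y x _))
                                (cong (_- x) (trans (sym (signedSum-∷⁺ h k x v)) e)))
            , (λ {v} e → trans (signedSum-∷⁺ h k x v) (trans (cong (_+_ x) e) (x+[y-x]≡y x S)))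

  Φ-suc⁻ : ∀ k m S n → Φ 0 (suc k) m S n ≡ ∑[ i < n ] Φ 0 k m (S + (m + + i)) n
  Φ-suc⁻ k m S n =
    trans (solutions-∷ (signedSum 0 (suc k)) (signedSum 0 k) S (_+_ S) (interval m n) equiv)
          (sum-map-interval _ m n)
    where
    equiv : ∀ x → (λ v → signedSum 0 (suc k) (x ∷ v) ≡ S) ≐ (λ v → signedSum 0 k v ≡ S + x)
    equiv x = (λ {v} e → trans (sym (y-x+x≡y x _))
                                (cong (_+ x) (trans (sym (signedSum-∷⁻ k x v)) e)))
            , (λ {v} e → trans (signedSum-∷⁻ k x v) (trans (cong (_- x) e) (y+x-x≡y x S)))

  Φ-0-0-≤1 : ∀ m S n → Φ 0 0 m S n ℕ.≤ 1
  Φ-0-0-≤1 m S n with signedSum 0 0 [] ≟ S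
  ... | yes _ = s≤s z≤n
  ... | no  _ = z≤n

  Φ-0-0-support : ∀ m S n → 0 ℕ.< Φ 0 0 m S n → S ≡ + 0
  Φ-0-0-support m S n Φ>0 with signedSum 0 0 [] ≟ S
  ... | yes 0≡S = sym 0≡S

  Φ-0-1-≤1 : ∀ m S n → Φ 0 1 m S n ℕ.≤ 1
  Φ-0-1-≤1 m S n = subst (ℕ._≤ 1) (sym (Φ-suc⁻ 0 m S n))
    (sumBelow-≤1 n (λ i → Φ-0-0-≤1 m (T i) n) injective)
    where
    T : ℕ → ℤ
    T i = S + (m + + i)
    i≡T-S-m : ∀ S m i → i ≡ (S + (m + i)) - S - m
    i≡T-S-m = solve-∀
    injective : ∀ i j → 0 ℕ.< Φ 0 0 m (T i) n → 0 ℕ.< Φ 0 0 m (T j) n → i ≡ j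
    injective i j Φᵢ>0 Φⱼ>0 = ℤₚ.+-injective (begin
      + i            ≡⟨ i≡T-S-m S m (+ i) ⟩
      T i - S - m    ≡⟨ cong (λ x → x - S - m) (Φ-0-0-support m (T i) n Φᵢ>0) ⟩
      + 0 - S - m    ≡⟨ cong (λ x → x - S - m) (Φ-0-0-support m (T j) n Φⱼ>0) ⟨
      T j - S - m    ≡⟨ i≡T-S-m S m (+ j) ⟨
      + j            ∎)

  Φ-upper : ∀ h k m S n → Φ h (suc k) m S n ℕ.≤ n ^ (h ℕ.+ k)
  Φ-upper zero    zero    m S n = Φ-0-1-≤1 m S n
  Φ-upper zero    (suc k) m S n rewrite Φ-suc⁻ (suc k) m S n =
    sumBelow-≤ n (λ i → Φ-upper 0 k m _ n)
  Φ-upper (suc h) k       m S n rewrite Φ-suc⁺ h (suc k) m S n =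
    sumBelow-≤ n (λ i → Φ-upper h k m _ n)

module Windows where
  open Sums
  open import Data.Nat as ℕ using (ℕ; suc; _∸_; _≤_)
  import Data.Nat.Properties as ℕₚ
  open import Data.Nat.Tactic.RingSolver using () renaming (solve-∀ to solve-ℕ)
  open import Data.Integer using (ℤ; +_; _+_; _-_; -_)
  import Data.Integer.Properties as ℤₚ
  open import Data.Integer.Tactic.RingSolver using (solve-∀)
  open import Function using (_∘_)
  open import Relation.Binary.PropositionalEquality

  -- A record rather than a function type, so that L, G, B and ℓ can be inferred.
  record AtLeastOn (L : ℕ) (G : ℤ → ℕ) (B : ℤ) (ℓ : ℕ) : Set where
    constructor atLeastOn
    field
      bound : ∀ v → v ≤ ℓ → L ≤ G (B + + v)

  AtLeastOn-cong : ∀ {L G G′ B B′ ℓ ℓ′} → (∀ S → G S ≡ G′ S) → B ≡ B′ → ℓ ≡ ℓ′ →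
    AtLeastOn L G B ℓ → AtLeastOn L G′ B′ ℓ′
  AtLeastOn-cong {L} G≗G′ refl refl (atLeastOn G≥L) =
    atLeastOn λ v v≤ℓ → subst (L ≤_) (G≗G′ _) (G≥L v v≤ℓ)

  pos-∸ : ∀ {m n} → n ≤ m → + (m ∸ n) ≡ + m - + n
  pos-∸ {m} {n} n≤m = trans (sym (ℤₚ.⊖-≥ n≤m)) (sym (ℤₚ.m-n≡m⊖n m n))

  AtLeastOn-sum⁺ : ∀ m {n} w r → n ≡ suc (w ℕ.+ w) ℕ.+ r →
    ∀ {L G B ℓ} → w ≤ ℓ → AtLeastOn L G B ℓ →
    AtLeastOn (suc w ℕ.* L) (λ S → ∑[ i < n ] G (S - (m + + i))) (B + (m + + w)) (ℓ ℕ.+ r)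
  AtLeastOn-sum⁺ m {n} w r n≡ {L} {G} {B} {ℓ} w≤ℓ (atLeastOn G≥L) = atLeastOn bound
    where
    -- For the target B + m + w + u the indices a, …, a + w with a = u ∸ (ℓ ∸ w)
    -- all put the remaining target S − m − i into [B, B + ℓ].
    bound : ∀ u → u ≤ ℓ ℕ.+ r → suc w ℕ.* L ≤ ∑[ i < n ] G ((B + (m + + w) + + u) - (m + + i))
    bound u u≤ℓ+r =
      sumBelow-window _ a w a+w<n λ j j≤w →
        subst (λ T → L ≤ G T) (sym (shift j j≤w)) (G≥L (v j) (v≤ℓ j))
      where
      d = ℓ ∸ w
      a = u ∸ d
      a≤u : a ≤ u
      a≤u = ℕₚ.m∸n≤m u d
      v : ℕ → ℕ
      v j = (w ∸ j) ℕ.+ (u ∸ a)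
      v≤ℓ : ∀ j → v j ≤ ℓ
      v≤ℓ j = ℕₚ.≤-trans (ℕₚ.+-mono-≤ (ℕₚ.m∸n≤m w j) (ℕₚ.m≤n+o⇒m∸n≤o u a u≤a+d))
                         (ℕₚ.≤-reflexive (ℕₚ.m+[n∸m]≡n w≤ℓ))
        where
        u≤a+d : u ≤ a ℕ.+ d
        u≤a+d = subst (u ≤_) (ℕₚ.+-comm d a) (ℕₚ.m≤n+m∸n u d)
      a≤w+r : a ≤ w ℕ.+ r
      a≤w+r = begin
        u ∸ d              ≤⟨ ℕₚ.∸-monoˡ-≤ d u≤ℓ+r ⟩
        (ℓ ℕ.+ r) ∸ d      ≡⟨ ℕₚ.+-∸-comm r (ℕₚ.m∸n≤m ℓ w) ⟩
        (ℓ ∸ d) ℕ.+ r      ≡⟨ cong (ℕ._+ r) (ℕₚ.m∸[m∸n]≡n w≤ℓ) ⟩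
        w ℕ.+ r            ∎
        where open ℕₚ.≤-Reasoning
      a+w<n : a ℕ.+ suc w ≤ n
      a+w<n = ℕₚ.≤-trans (ℕₚ.+-monoˡ-≤ (suc w) a≤w+r)
                         (ℕₚ.≤-reflexive (trans (rearrange w r) (sym n≡)))
        where
        rearrange : ∀ w r → w ℕ.+ r ℕ.+ suc w ≡ suc (w ℕ.+ w) ℕ.+ r
        rearrange = solve-ℕ
      shift : ∀ j → j ≤ w → (B + (m + + w) + + u) - (m + + (a ℕ.+ j)) ≡ B + + v j
      shift j j≤w = begin
        (B + (m + + w) + + u) - (m + + (a ℕ.+ j))
          ≡⟨ cong (λ x → (B + (m + + w) + + u) - (m + x)) (ℤₚ.pos-+ a j) ⟩
        (B + (m + + w) + + u) - (m + (+ a + + j))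
          ≡⟨ regroup B m (+ w) (+ u) (+ a) (+ j) ⟩
        B + ((+ w - + j) + (+ u - + a))
          ≡⟨ cong₂ (λ x y → B + (x + y)) (pos-∸ j≤w) (pos-∸ a≤u) ⟨
        B + (+ (w ∸ j) + + (u ∸ a))
          ≡⟨ cong (_+_ B) (ℤₚ.pos-+ (w ∸ j) (u ∸ a)) ⟨
        B + + v j
          ∎
        where
        regroup : ∀ B m W U A J → (B + (m + W) + U) - (m + (A + J)) ≡ B + ((W - J) + (U - A))
        regroup = solve-∀
        open ≡-Reasoning

  AtLeastOn-reflect : ∀ {L G B ℓ} → AtLeastOn L G B ℓ → AtLeastOn L (G ∘ -_) (- (B + + ℓ)) ℓ
  AtLeastOn-reflect {L} {G} {B} {ℓ} (atLeastOn G≥L) = atLeastOn λ v v≤ℓ →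
    subst (λ T → L ≤ G T) (mirror v v≤ℓ) (G≥L (ℓ ∸ v) (ℕₚ.m∸n≤m ℓ v))
    where
    reflect : ∀ B L V → B + (L - V) ≡ - (- (B + L) + V)
    reflect = solve-∀
    mirror : ∀ v → v ≤ ℓ → B + + (ℓ ∸ v) ≡ - (- (B + + ℓ) + + v)
    mirror v v≤ℓ = trans (cong (_+_ B) (pos-∸ v≤ℓ)) (reflect B (+ ℓ) (+ v))

  AtLeastOn-sum⁻ : ∀ m {n} w r → n ≡ suc (w ℕ.+ w) ℕ.+ r →
    ∀ {L G B ℓ} → w ≤ ℓ → AtLeastOn L G B ℓ →
    AtLeastOn (suc w ℕ.* L) (λ S → ∑[ i < n ] G (S + (m + + i)))
              (B - (m + + (w ℕ.+ r))) (ℓ ℕ.+ r)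
  AtLeastOn-sum⁻ m {n} w r n≡ {G = G} {B} {ℓ} w≤ℓ G≥L =
    AtLeastOn-cong unreflect start refl
      (AtLeastOn-reflect (AtLeastOn-sum⁺ m w r n≡ w≤ℓ (AtLeastOn-reflect G≥L)))
    where
    unreflect : ∀ S → ∑[ i < n ] G (- (- S - (m + + i))) ≡ ∑[ i < n ] G (S + (m + + i))
    unreflect S = sumBelow-cong n (λ i → cong G (neg-neg-sub S (m + + i)))
      where
      neg-neg-sub : ∀ S X → - (- S - X) ≡ S + X
      neg-neg-sub = solve-∀
    start : - ((- (B + + ℓ) + (m + + w)) + + (ℓ ℕ.+ r)) ≡ B - (m + + (w ℕ.+ r))
    start = begin
      - ((- (B + + ℓ) + (m + + w)) + + (ℓ ℕ.+ r))
        ≡⟨ cong (λ x → - ((- (B + + ℓ) + (m + + w)) + x)) (ℤₚ.pos-+ ℓ r) ⟩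
      - ((- (B + + ℓ) + (m + + w)) + (+ ℓ + + r))
        ≡⟨ regroup B (+ ℓ) m (+ w) (+ r) ⟩
      B - (m + (+ w + + r))
        ≡⟨ cong (λ x → B - (m + x)) (ℤₚ.pos-+ w r) ⟨
      B - (m + + (w ℕ.+ r))
        ∎
      where
      regroup : ∀ B L m W R → - ((- (B + L) + (m + W)) + (L + R)) ≡ B - (m + (W + R))
      regroup = solve-∀
      open ≡-Reasoning

module LowerBound where
  open Recurrence
  open Windows
  open import Data.Nat as ℕ using (ℕ; zero; suc; _^_; _≤_; z≤n; s≤s)
  import Data.Nat.Properties as ℕₚ
  open import Data.Nat.Tactic.RingSolver using () renaming (solve-∀ to solve-ℕ)
  open import Data.Integer using (ℤ; +_; -[1+_]; _+_; _-_; -_; _*_; ∣_∣)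
  open import Data.Product using (Σ; _×_; _,_)
  import Data.Integer.Properties as ℤₚ
  open import Data.Integer.Tactic.RingSolver using (solve-∀)
  open import Relation.Binary.PropositionalEquality

  i+∣i∣∈[0,2∣i∣] : ∀ i → Σ ℕ λ p → i + + ∣ i ∣ ≡ + p × p ≤ ∣ i ∣ ℕ.+ ∣ i ∣
  i+∣i∣∈[0,2∣i∣] (+ a)      = a ℕ.+ a , sym (ℤₚ.pos-+ a a) , ℕₚ.≤-refl
  i+∣i∣∈[0,2∣i∣] -[1+ a ] = 0 , ℤₚ.+-inverseˡ (+ suc a) , z≤n

  pos-affine : ∀ a b c → + (a ℕ.+ b ℕ.* c) ≡ + a + + b * + c
  pos-affine a b c = trans (ℤₚ.pos-+ a (b ℕ.* c)) (cong (_+_ (+ a)) (ℤₚ.pos-* b c))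

  module _ (m : ℤ) (n w r : ℕ) (n≡ : n ≡ suc (w ℕ.+ w) ℕ.+ r) where

    r₀ : ℕ
    r₀ = w ℕ.+ w ℕ.+ r

    start : ℕ → ℕ → ℤ
    start h k = - m - + r₀ - + k * (m + + (w ℕ.+ r)) + + h * (m + + w)

    len : ℕ → ℕ → ℕ
    len h k = r₀ ℕ.+ (h ℕ.+ k) ℕ.* r

    Φ-0-0-window : AtLeastOn 1 (λ S → Φ 0 0 m S n) (+ 0) 0
    Φ-0-0-window = atLeastOn λ { zero z≤n → s≤s z≤n }

    w≤len : ∀ h k → w ≤ len h k
    w≤len h k = ℕₚ.≤-trans (ℕₚ.≤-trans (ℕₚ.m≤m+n w w) (ℕₚ.m≤m+n (w ℕ.+ w) r)) (ℕₚ.m≤m+n r₀ _)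

    start-suc⁻ : ∀ k → start 0 k - (m + + (w ℕ.+ r)) ≡ start 0 (suc k)
    start-suc⁻ k =
      trans (step (- m - + r₀) (+ k) (m + + (w ℕ.+ r)) (m + + w))
            (cong (λ K → - m - + r₀ - K * (m + + (w ℕ.+ r)) + + 0 * (m + + w)) (sym (ℤₚ.pos-+ 1 k)))
      where
      step : ∀ A K X Y → A - K * X + + 0 * Y - X ≡ A - (+ 1 + K) * X + + 0 * Y
      step = solve-∀

    start-suc⁺ : ∀ h k → start h k + (m + + w) ≡ start (suc h) k
    start-suc⁺ h k =
      trans (step (- m - + r₀ - + k * (m + + (w ℕ.+ r))) (+ h) (m + + w))
            (cong (λ H → - m - + r₀ - + k * (m + + (w ℕ.+ r)) + H * (m + + w)) (sym (ℤₚ.pos-+ 1 h)))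
      where
      step : ∀ A H Y → A + H * Y + Y ≡ A + (+ 1 + H) * Y
      step = solve-∀

    len-suc : ∀ h k → len h k ℕ.+ r ≡ len (suc h) k
    len-suc h k = step r₀ (h ℕ.+ k) r
      where
      step : ∀ r₀ j r → r₀ ℕ.+ j ℕ.* r ℕ.+ r ≡ r₀ ℕ.+ suc j ℕ.* r
      step = solve-ℕ

    Φ-window : ∀ h k →
      AtLeastOn (suc w ^ (h ℕ.+ k)) (λ S → Φ h (suc k) m S n) (start h k) (len h k)
    -- The first step uses width 0: Φ₀,₁ ≥ 1 on a window of length n − 1.
    Φ-window zero zero =
      AtLeastOn-cong (λ S → sym (Φ-suc⁻ 0 m S n)) (base m (+ r₀) (m + + (w ℕ.+ r)) (m + + w))
                     (sym (ℕₚ.+-identityʳ r₀))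
                     (AtLeastOn-sum⁻ m 0 r₀ n≡ z≤n Φ-0-0-window)
      where
      base : ∀ m R X Y → + 0 - (m + R) ≡ - m - R - + 0 * X + + 0 * Y
      base = solve-∀
    Φ-window zero (suc k) =
      AtLeastOn-cong (λ S → sym (Φ-suc⁻ (suc k) m S n)) (start-suc⁻ k) (len-suc 0 k)
                     (AtLeastOn-sum⁻ m w r n≡ (w≤len 0 k) (Φ-window 0 k))
    Φ-window (suc h) k =
      AtLeastOn-cong (λ S → sym (Φ-suc⁺ h (suc k) m S n)) (start-suc⁺ h k) (len-suc h k)
                     (AtLeastOn-sum⁺ m w r n≡ (w≤len h k) (Φ-window h k))

    offset : ℕ → ℕ → ℕ → ℕ
    offset k p s = p ℕ.+ (w ℕ.+ k ℕ.* w) ℕ.+ (w ℕ.+ k ℕ.* w) ℕ.+ s ℕ.+ k ℕ.* r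

    offset≤len : ∀ h k kk p s → r ≡ (suc h ℕ.+ k) ℕ.* w ℕ.+ kk ℕ.+ s → p ≤ kk ℕ.+ kk →
      offset k p s ≤ len (suc h) k
    offset≤len h k kk p s r≡ p≤2kk = subst
      (λ r → p ℕ.+ (w ℕ.+ k ℕ.* w) ℕ.+ (w ℕ.+ k ℕ.* w) ℕ.+ s ℕ.+ k ℕ.* r
               ≤ w ℕ.+ w ℕ.+ r ℕ.+ (suc h ℕ.+ k) ℕ.* r)
      (sym r≡)
      (ℕₚ.≤-trans (ℕₚ.+-monoˡ-≤ _ (ℕₚ.+-monoˡ-≤ s (ℕₚ.+-monoˡ-≤ _ (ℕₚ.+-monoˡ-≤ _ p≤2kk))))
                  (ℕₚ.≤-trans (ℕₚ.m≤m+n _ _) (ℕₚ.≤-reflexive (balance h k w kk s))))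
      where
      balance : ∀ h k w kk s → let r = (suc h ℕ.+ k) ℕ.* w ℕ.+ kk ℕ.+ s in
        kk ℕ.+ kk ℕ.+ (w ℕ.+ k ℕ.* w) ℕ.+ (w ℕ.+ k ℕ.* w) ℕ.+ s ℕ.+ k ℕ.* r
          ℕ.+ (suc h ℕ.* w ℕ.+ suc h ℕ.* w ℕ.+ s ℕ.+ h ℕ.* r)
        ≡ w ℕ.+ w ℕ.+ r ℕ.+ (suc h ℕ.+ k) ℕ.* r
      balance = solve-ℕ

    start+offset≡ : ∀ h k c kk p s → r ≡ (suc h ℕ.+ k) ℕ.* w ℕ.+ kk ℕ.+ s →
      c + m + + k * m - + suc h * m + + kk ≡ + p → start (suc h) k + + offset k p s ≡ c
    start+offset≡ h k c kk p s r≡ K+kk≡p = begin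
      start (suc h) k + + offset k p s
        ≡⟨ cong₂ _+_ (cong₂ (λ X Y → - m - X - + k * (m + Y) + + suc h * (m + + w))
                            +r₀ (ℤₚ.pos-+ w r))
                      +offset ⟩
      E (+ p) (+ r)
        ≡⟨ cong₂ E (sym K+kk≡p) (trans (cong +_ r≡) +r) ⟩
      E (c + m + + k * m - + suc h * m + + kk) ((+ suc h + + k) * + w + + kk + + s)
        ≡⟨ balance c m (+ suc h) (+ k) (+ w) (+ kk) (+ s) ⟩
      c ∎
      where
      open ≡-Reasoning
      E : ℤ → ℤ → ℤ
      E P R = - m - (+ w + + w + R) - + k * (m + (+ w + R)) + + suc h * (m + + w)
              + (P + (+ w + + k * + w) + (+ w + + k * + w) + + s + + k * R)
      +r₀ : + r₀ ≡ + w + + w + + r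
      +r₀ = trans (ℤₚ.pos-+ (w ℕ.+ w) r) (cong (_+ + r) (ℤₚ.pos-+ w w))
      +offset : + offset k p s ≡ + p + (+ w + + k * + w) + (+ w + + k * + w) + + s + + k * + r
      +offset = trans (pos-affine (p ℕ.+ A ℕ.+ A ℕ.+ s) k r)
        (cong (_+ + k * + r) (trans (ℤₚ.pos-+ (p ℕ.+ A ℕ.+ A) s) (cong (_+ + s)
          (trans (ℤₚ.pos-+ (p ℕ.+ A) A)
                 (cong₂ _+_ (trans (ℤₚ.pos-+ p A) (cong (_+_ (+ p)) +A)) +A)))))
        where
        A = w ℕ.+ k ℕ.* w
        +A : + A ≡ + w + + k * + w
        +A = pos-affine w k w
      +r : + ((suc h ℕ.+ k) ℕ.* w ℕ.+ kk ℕ.+ s) ≡ (+ suc h + + k) * + w + + kk + + s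
      +r = trans (ℤₚ.pos-+ _ s) (cong (_+ + s) (trans (ℤₚ.pos-+ _ kk) (cong (_+ + kk)
             (trans (ℤₚ.pos-* (suc h ℕ.+ k) w) (cong (_* + w) (ℤₚ.pos-+ (suc h) k))))))
      balance : ∀ c m H K W KK S → let R = (H + K) * W + KK + S in
        - m - (W + W + R) - K * (m + (W + R)) + H * (m + W)
          + ((c + m + K * m - H * m + KK) + (W + K * W) + (W + K * W) + S + K * R) ≡ c
      balance = solve-∀

    Φ-lower : ∀ h k c s → r ≡ (suc h ℕ.+ k) ℕ.* w ℕ.+ ∣ c + m + + k * m - + suc h * m ∣ ℕ.+ s →
      suc w ^ (suc h ℕ.+ k) ≤ Φ (suc h) (suc k) m c n
    Φ-lower h k c s r≡ with i+∣i∣∈[0,2∣i∣] (c + m + + k * m - + suc h * m)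
    ... | p , K+kk≡p , p≤2kk =
      subst (λ T → suc w ^ (suc h ℕ.+ k) ≤ Φ (suc h) (suc k) m T n)
            (start+offset≡ h k c _ p s r≡ K+kk≡p)
            (AtLeastOn.bound (Φ-window (suc h) k) (offset k p s) (offset≤len h k _ p s r≡ p≤2kk))

module Scale where
  open LowerBound using (Φ-lower)
  open import Data.Nat using (ℕ; zero; suc; _+_; _*_; _∸_; _^_; _≤_; NonZero)
  import Data.Nat.Properties as ℕₚ
  open import Data.Nat.Tactic.RingSolver using (solve-∀)
  open import Data.Nat.DivMod using (_/_; _%_; m≡m%n+[m/n]*n; m/n*n≤m; m%n<n)
  import Data.Integer as ℤ
  open import Data.Product using (Σ; _,_; proj₁; proj₂)
  open import Relation.Binary.PropositionalEquality

  m≤[1+m/n]*n : ∀ m n .{{_ : NonZero n}} → m ≤ suc (m / n) * n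
  m≤[1+m/n]*n m n = begin
    m                  ≡⟨ m≡m%n+[m/n]*n m n ⟩
    m % n + m / n * n  ≤⟨ ℕₚ.+-monoˡ-≤ (m / n * n) (ℕₚ.<⇒≤ (m%n<n m n)) ⟩
    suc (m / n) * n    ∎
    where open ℕₚ.≤-Reasoning

  ^-distribʳ-* : ∀ a b e → (a * b) ^ e ≡ a ^ e * b ^ e
  ^-distribʳ-* a b zero    = refl
  ^-distribʳ-* a b (suc e) =
    trans (cong (a * b *_) (^-distribʳ-* a b e)) (interchange a b (a ^ e) (b ^ e))
    where
    interchange : ∀ a b x y → a * b * (x * y) ≡ a * x * (b * y)
    interchange = solve-∀

  scale : ℕ → ℕ
  scale a = suc (suc a) + suc (suc a)

  split-at-scale : ∀ a kk n → 2 + (kk + kk) ≤ n →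
    Σ ℕ λ s → n ≡ suc (n / scale a + n / scale a) + (a * (n / scale a) + kk + s)
  split-at-scale a kk n n≥ =
    n ∸ x , trans (sym (ℕₚ.m+[n∸m]≡n x≤n)) (regroup a (n / scale a) kk (n ∸ x))
    where
    w = n / scale a
    x = suc (suc a) * w + kk + 1
    x≤n : x ≤ n
    x≤n = ℕₚ.*-cancelˡ-≤ 2 (begin
      2 * x                            ≡⟨ double a w kk ⟩
      w * scale a + (2 + (kk + kk))    ≤⟨ ℕₚ.+-mono-≤ (m/n*n≤m n (scale a)) n≥ ⟩
      n + n                            ≡⟨ cong (n +_) (ℕₚ.+-identityʳ n) ⟨
      2 * n                            ∎)
      where
      open ℕₚ.≤-Reasoning
      double : ∀ a w kk →
        2 * (suc (suc a) * w + kk + 1) ≡ w * (suc (suc a) + suc (suc a)) + (2 + (kk + kk))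
      double = solve-∀
    regroup : ∀ a w kk s → suc (suc a) * w + kk + 1 + s ≡ suc (w + w) + (a * w + kk + s)
    regroup = solve-∀

  Φ-lower-bound : ∀ h k m c n → let κ = ℤ.∣ c ℤ.+ m ℤ.+ ℤ.+ k ℤ.* m ℤ.- ℤ.+ suc h ℤ.* m ∣ in
    2 + (κ + κ) ≤ n → n ^ (suc h + k) ≤ scale (suc h + k) ^ (suc h + k) * Φ (suc h) (suc k) m c n
  Φ-lower-bound h k m c n n≥ = begin
    n ^ a                     ≤⟨ ℕₚ.^-monoˡ-≤ a (m≤[1+m/n]*n n M) ⟩
    (suc w * M) ^ a           ≡⟨ ^-distribʳ-* (suc w) M a ⟩
    suc w ^ a * M ^ a         ≡⟨ ℕₚ.*-comm (suc w ^ a) (M ^ a) ⟩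
    M ^ a * suc w ^ a         ≤⟨ ℕₚ.*-monoʳ-≤ (M ^ a) (Φ-lower m n w _ n≡ h k c s refl) ⟩
    M ^ a * Φ (suc h) (suc k) m c n ∎
    where
    open ℕₚ.≤-Reasoning
    a = suc h + k
    M = scale a
    w = n / M
    split = split-at-scale a _ n n≥
    s = proj₁ split
    n≡ = proj₂ split


module Rationals where
  open import Data.Nat as ℕ using (ℕ; NonZero)
  open import Data.Integer as ℤ using (+_)
  import Data.Integer.Properties as ℤₚ
  import Data.Nat.Coprimality as Coprime
  open import Data.Rational using (ℚ; mkℚ; _/_; _≤_; _<_; _*_; 0ℚ; 1ℚ; 1/_)
  import Data.Rational as ℚ
  import Data.Rational.Properties as ℚₚ
  open import Relation.Binary.PropositionalEquality

  +n/1≡mkℚ : ∀ n → + n / 1 ≡ mkℚ (+ n) 0 (Coprime.sym (Coprime.1-coprimeTo n))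
  +n/1≡mkℚ n = ℚₚ.normalize-coprime (Coprime.sym (Coprime.1-coprimeTo n))

  /1-mono-≤ : ∀ {a b} → a ℕ.≤ b → + a / 1 ≤ + b / 1
  /1-mono-≤ {a} {b} a≤b rewrite +n/1≡mkℚ a | +n/1≡mkℚ b =
    ℚ.*≤* (subst₂ ℤ._≤_ (sym (ℤₚ.*-identityʳ (+ a))) (sym (ℤₚ.*-identityʳ (+ b))) (ℤ.+≤+ a≤b))

  /1-* : ∀ a b → (+ a / 1) * (+ b / 1) ≡ + (a ℕ.* b) / 1
  /1-* a b rewrite +n/1≡mkℚ a | +n/1≡mkℚ b = cong (_/ 1) (sym (ℤₚ.pos-* a b))

  private instance
    /1-positive : ∀ {d} .{{_ : NonZero d}} → ℚ.Positive (+ d / 1)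
    /1-positive {d} = ℚₚ.normalize-pos d 1

    /1-nonZero : ∀ {d} .{{_ : NonZero d}} → ℚ.NonZero (+ d / 1)
    /1-nonZero {d} = ℚₚ.pos⇒nonZero (+ d / 1)

  1/ℕ : (d : ℕ) .{{_ : NonZero d}} → ℚ
  1/ℕ d = 1/ (+ d / 1)

  1/ℕ-positive : ∀ d .{{_ : NonZero d}} → 0ℚ < 1/ℕ d
  1/ℕ-positive d = ℚₚ.positive⁻¹ _ {{ℚₚ.1/pos⇒pos (+ d / 1)}}

  scaled-≤ : ∀ d .{{_ : NonZero d}} a b → a ℕ.≤ d ℕ.* b → 1/ℕ d * (+ a / 1) ≤ + b / 1
  scaled-≤ d a b a≤db = begin
    θ * (+ a / 1)               ≤⟨ ℚₚ.*-monoˡ-≤-nonNeg θ {{θ≥0}} (/1-mono-≤ a≤db) ⟩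
    θ * (+ (d ℕ.* b) / 1)       ≡⟨ cong (θ *_) (/1-* d b) ⟨
    θ * ((+ d / 1) * (+ b / 1)) ≡⟨ ℚₚ.*-assoc θ _ _ ⟨
    θ * (+ d / 1) * (+ b / 1)   ≡⟨ cong (_* (+ b / 1)) (ℚₚ.*-inverseˡ (+ d / 1)) ⟩
    1ℚ * (+ b / 1)              ≡⟨ ℚₚ.*-identityˡ _ ⟩
    + b / 1                     ∎
    where
    open ℚₚ.≤-Reasoning
    θ = 1/ℕ d
    θ≥0 : ℚ.NonNegative θ
    θ≥0 = ℚₚ.pos⇒nonNeg θ {{ℚₚ.1/pos⇒pos (+ d / 1)}}

open Recurrence using (Φ-upper)
open Scale using (scale; Φ-lower-bound)
open Rationals using (1/ℕ; 1/ℕ-positive; scaled-≤)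

open import Data.Nat as ℕ using (ℕ; _^_; _∸_; _≥_; NonZero)
import Data.Nat.Properties as ℕₚ
open import Data.Integer as ℤ using (ℤ)
open import Data.Rational as ℚ using (ℚ; _≤_; _<_; _*_; 0ℚ)
open import Data.Product using (Σ; _×_; _,_)
open import Relation.Binary.PropositionalEquality using (_≡_; sym; subst)

mainTheorem3 : (h k : ℕ) → .{{NonZero h}} → .{{NonZero k}} → (m c : ℤ) →
    Σ ℚ λ θ → (0ℚ < θ) × Σ ℕ λ N → (n : ℕ) → n ≥ N →
      (θ * ((ℤ.+ (n ^ (h ℕ.+ k ∸ 1))) ℚ./ 1) ≤ ((ℤ.+ (Φ h k m c n)) ℚ./ 1))
      × (Φ h k m c n ℕ.≤ n ^ (h ℕ.+ k ∸ 1))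
mainTheorem3 (ℕ.suc h) (ℕ.suc k) m c =
  1/ℕ (M ^ e) , 1/ℕ-positive (M ^ e) , 2 ℕ.+ (κ ℕ.+ κ) , λ n n≥N → lower n n≥N , upper n
  where
  e = h ℕ.+ ℕ.suc k
  e≡ : ℕ.suc h ℕ.+ k ≡ e
  e≡ = sym (ℕₚ.+-suc h k)
  κ = ℤ.∣ c ℤ.+ m ℤ.+ ℤ.+ k ℤ.* m ℤ.- ℤ.+ ℕ.suc h ℤ.* m ∣
  M = scale (ℕ.suc h ℕ.+ k)
  instance
    M^e≢0 : NonZero (M ^ e)
    M^e≢0 = ℕₚ.m^n≢0 M e
  Φₙ : ℕ → ℕ
  Φₙ = Φ (ℕ.suc h) (ℕ.suc k) m c
  upper : ∀ n → Φₙ n ℕ.≤ n ^ e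
  upper n = subst (λ j → Φₙ n ℕ.≤ n ^ j) e≡ (Φ-upper (ℕ.suc h) k m c n)
  lower : ∀ n → n ≥ 2 ℕ.+ (κ ℕ.+ κ) → 1/ℕ (M ^ e) * (ℤ.+ (n ^ e) ℚ./ 1) ≤ ℤ.+ Φₙ n ℚ./ 1
  lower n n≥N = scaled-≤ (M ^ e) (n ^ e) (Φₙ n)
    (subst (λ j → n ^ j ℕ.≤ M ^ j ℕ.* Φₙ n) e≡ (Φ-lower-bound h k m c n n≥N))
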